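{- Let $\mathcal{G}_n$ be the set of words over $\{0,1\}$ with $n$ zeros and $n$ ones. For all $n,k\ge0$, $$|\{w\in\mathcal{G}_n:\mathrm{sz}(w)=k\}|=|\{w\in\mathcal{G}_n:o_{00}(w)=k\}|=|\{w\in\mathcal{G}_n:\#_{001}(w)=k\}|.$$
   Context: For $w=w_1\cdots w_{2n}\in\mathcal{G}_n$: $\mathrm{sz}(w)=|\{i\in\{1,\dots,n\}: w_i=w_{2n+1-i}=0\}|$ (number of symmetrically positioned pairs of zeros); $o_{00}(w)=|\{i\in\{1,\dots,n\}: w_{2i-1}w_{2i}=00\}|$ (occurrences of the consecutive subword $00$ starting at an odd position); $\#_{001}(w)$ is the number of occurrences of $001$ as a consecutive subword of $w$ (i.e., the number of $j$ with $w_jw_{j+1}w_{j+2}=001$). -}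

module Defs where

open import Data.Bool using (Bool; true; false)
open import Data.Nat using (ℕ; zero; suc; _+_)
open import Data.List using (List; []; _∷_; _++_; map; length; filter)
open import Data.Vec using (Vec; []; _∷_; reverse)
open import Relation.Nullary using (Dec; yes; no)
open import Data.Product using (_×_; _,_)
open import Relation.Nullary.Decidable using (_×-dec_)
open import Relation.Binary.PropositionalEquality using (_≡_)
import Data.Nat as ℕ

-- Letters: false = 0, true = 1.

allWords : (m : ℕ) → List (Vec Bool m)
allWords zero = [] ∷ []
allWords (suc m) = map (false ∷_) (allWords m) ++ map (true ∷_) (allWords m)

zeros : ∀ {m} → Vec Bool m → ℕ
zeros [] = 0
zeros (false ∷ w) = suc (zeros w)
zeros (true ∷ w) = zeros w

ones : ∀ {m} → Vec Bool m → ℕ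
ones [] = 0
ones (false ∷ w) = ones w
ones (true ∷ w) = suc (ones w)

InG : (n : ℕ) → Vec Bool (n + n) → Set
InG n w = (zeros w ≡ n) × (ones w ≡ n)

-- sz(w): number of i ∈ {1..n} with w_i = w_{2n+1-i} = 0.
-- Pairing w with its reverse, this counts positions j in {1..2n} with
-- w_j = w_{2n+1-j} = 0, which is 2·sz(w); we count only the first n positions.
szAux : ∀ {m} → ℕ → Vec Bool m → Vec Bool m → ℕ
szAux zero _ _ = 0
szAux (suc k) [] [] = 0
szAux (suc k) (false ∷ u) (false ∷ v) = suc (szAux k u v)
szAux (suc k) (_ ∷ u) (_ ∷ v) = szAux k u v

sz : (n : ℕ) → Vec Bool (n + n) → ℕ
sz n w = szAux n w (reverse w)

o00 : ∀ {m} → Vec Bool m → ℕ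
o00 (false ∷ false ∷ w) = suc (o00 w)
o00 (_ ∷ _ ∷ w) = o00 w
o00 _ = 0

occ001 : ∀ {m} → Vec Bool m → ℕ
occ001 (false ∷ false ∷ true ∷ w) = suc (occ001 (false ∷ true ∷ w))
occ001 (_ ∷ w) = occ001 w
occ001 [] = 0

countG : (n : ℕ) → (Vec Bool (n + n) → ℕ) → ℕ → ℕ
countG n stat k =
  length (filter (λ w → ((zeros w ℕ.≟ n) ×-dec (ones w ℕ.≟ n)) ×-dec (stat w ℕ.≟ k))
                 (allWords (n + n)))

-- Both equalities come from bijections of G_n carrying one statistic to the other.
-- Interleaving the first half of w with its reversed second half turns the symmetric pairs
-- (w_i, w_{2n+1-i}) into the pairs (w_{2i-1}, w_{2i}), so it carries sz to o_00.
-- For #_001, mark every 0 of w by whether a 1 follows it and every 1 by whether a 0 precedes it: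
-- the two lists of marks z₁ and o₁ have length n, contain one 1 per factor 01 of w, and determine w.
-- Marking z₁ in the same way gives z₂ and o₂, and the 1s of o₂ are the factors 001 of w. Let u be the
-- complement of o₁ and v the word carrying the complement of o₂ below the 0s of u and z₂ below its 1s.
-- Interleaving u with v gives a word of G_n whose pairs 00 correspond to the 1s of o₂, and every word
-- of G_n arises in this way from exactly one triple (o₁, o₂, z₂).

module Submission where

open import Defs
open import Data.Bool using (Bool; true; false; not)
open import Data.Bool.Properties using (not-involutive)
open import Data.List using (List; []; _∷_; _++_; [_]; map; length; filter; reverse; take; drop)
open import Data.List.Properties
  using (length-++; length-map; length-reverse; length-take; length-drop; take++drop≡id; reverse-++;
         reverse-involutive; unfold-reverse; map-∘; map-id; map-cong; map-id-local; filter-≐)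
open import Data.List.Membership.Propositional using (_∈_)
open import Data.List.Membership.Propositional.Properties
  using (∈-map⁺; ∈-map⁻; ∈-++⁺ˡ; ∈-++⁺ʳ; ∈-filter⁺; ∈-filter⁻; ∈-map∘filter⁻)
open import Data.List.Membership.Propositional.Properties.WithK using (unique∧set⇒bag)
open import Data.List.Relation.Binary.BagAndSetEquality using (∼bag⇒↭)
open import Data.List.Relation.Binary.Permutation.Propositional.Properties using (↭-length)
import Data.List.Relation.Unary.All as All
open import Data.List.Relation.Unary.All.Properties using (all-filter)
import Data.List.Relation.Unary.AllPairs as AllPairs
open import Data.List.Relation.Unary.Any using (here)
open import Data.List.Relation.Unary.Unique.Propositional using (Unique)
import Data.List.Relation.Unary.Unique.Propositional.Properties as Unique
open import Data.Nat using (ℕ; zero; suc; _+_; _∸_; _⊓_)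
import Data.Nat as ℕ
open import Data.Nat.Properties
  using (+-comm; +-assoc; +-suc; +-cancelˡ-≡; +-cancelʳ-≡; suc-injective; m≤m+n; m≤n⇒m⊓n≡m; m+n∸m≡n;
         +-commutativeSemigroup)
open import Data.Product using (_×_; _,_; proj₁; proj₂; ∃₂)
import Data.Product as Product
open import Data.Sum using (_⊎_; inj₁; inj₂)
open import Data.Vec using (Vec; toList; fromList; cast)
import Data.Vec as Vec
open import Data.Vec.Properties
  using (toList-injective; toList∘fromList; fromList∘toList; toList-reverse; length-toList; cast-is-id; ∷-injectiveʳ)
open import Function using (_∘_; id)
open import Function.Bundles using (_⇔_; mk⇔)
open import Relation.Nullary using (does; ¬_)
open import Relation.Nullary.Decidable using (_×-dec_)
open import Relation.Unary using (Decidable; _⊆_)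
open import Relation.Binary.PropositionalEquality using (_≡_; refl; sym; trans; cong; cong₂; subst; module ≡-Reasoning)
open import Algebra.Properties.CommutativeSemigroup +-commutativeSemigroup using (interchange; x∙yz≈y∙xz)

open ≡-Reasoning

module _ {A : Set} {P Q : A → Set} (P? : Decidable P) (Q? : Decidable Q)
         (to from : A → A)
         (to-Q : ∀ x → P x → Q (to x)) (from-P : ∀ y → Q y → P (from y))
         (from∘to : ∀ x → P x → from (to x) ≡ x) (to∘from : ∀ y → Q y → to (from y) ≡ y)
         where

  length-filter-bijection : (xs : List A) → Unique xs → P ⊆ (_∈ xs) → Q ⊆ (_∈ xs) →
                            length (filter P? xs) ≡ length (filter Q? xs)
  length-filter-bijection xs xs! P⊆xs Q⊆xs = begin
    length (filter P? xs)          ≡⟨ length-map to (filter P? xs) ⟨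
    length (map to (filter P? xs)) ≡⟨ ↭-length (∼bag⇒↭ (unique∧set⇒bag image! filter! same-elements)) ⟩
    length (filter Q? xs)          ∎
    where
    filter! : Unique (filter Q? xs)
    filter! = Unique.filter⁺ Q? xs!
    image! : Unique (map to (filter P? xs))
    image! = Unique.map⁻ (subst Unique (sym from∘to-on-filter) (Unique.filter⁺ P? xs!))
      where
      from∘to-on-filter : map from (map to (filter P? xs)) ≡ filter P? xs
      from∘to-on-filter = trans (sym (map-∘ (filter P? xs))) (map-id-local (All.map (from∘to _) (all-filter P? xs)))
    same-elements : ∀ {y} → y ∈ map to (filter P? xs) ⇔ y ∈ filter Q? xs
    same-elements = mk⇔ image⊆ ⊆image
      where
      image⊆ : ∀ {y} → y ∈ map to (filter P? xs) → y ∈ filter Q? xs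
      image⊆ y∈ with ∈-map∘filter⁻ to P? {xs = xs} y∈
      ... | x , _ , refl , Px = ∈-filter⁺ Q? (Q⊆xs (to-Q x Px)) (to-Q x Px)
      ⊆image : ∀ {y} → y ∈ filter Q? xs → y ∈ map to (filter P? xs)
      ⊆image {y} y∈ with ∈-filter⁻ Q? {xs = xs} y∈
      ... | _ , Qy = subst (_∈ map to (filter P? xs)) (to∘from y Qy)
                       (∈-map⁺ to (∈-filter⁺ P? (P⊆xs (from-P y Qy)) (from-P y Qy)))

filter-map : {A B : Set} {P : B → Set} (P? : Decidable P) (f : A → B) (xs : List A) →
             filter P? (map f xs) ≡ map f (filter (P? ∘ f) xs)
filter-map P? f [] = refl
filter-map P? f (x ∷ xs) with does (P? (f x))
... | true  = cong (f x ∷_) (filter-map P? f xs)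
... | false = filter-map P? f xs

∈-allWords : ∀ {m} (w : Vec Bool m) → w ∈ allWords m
∈-allWords Vec.[] = here refl
∈-allWords (false Vec.∷ w) = ∈-++⁺ˡ (∈-map⁺ (false Vec.∷_) (∈-allWords w))
∈-allWords (true Vec.∷ w) = ∈-++⁺ʳ _ (∈-map⁺ (true Vec.∷_) (∈-allWords w))

allWords-unique : ∀ m → Unique (allWords m)
allWords-unique zero = All.[] AllPairs.∷ AllPairs.[]
allWords-unique (suc m) =
  Unique.++⁺ (Unique.map⁺ ∷-injectiveʳ (allWords-unique m)) (Unique.map⁺ ∷-injectiveʳ (allWords-unique m))
             heads-differ
  where
  heads-differ : ∀ {v} → ¬ (v ∈ map (false Vec.∷_) (allWords m) × v ∈ map (true Vec.∷_) (allWords m))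
  heads-differ (v∈₀ , v∈₁) with ∈-map⁻ (false Vec.∷_) v∈₀ | ∈-map⁻ (true Vec.∷_) v∈₁
  ... | _ , _ , refl | _ , _ , ()

words : ℕ → List (List Bool)
words m = map toList (allWords m)

words-unique : ∀ m → Unique (words m)
words-unique m = Unique.map⁺ toList-injective′ (allWords-unique m)
  where
  toList-injective′ : ∀ {v w : Vec Bool m} → toList v ≡ toList w → v ≡ w
  toList-injective′ {v} {w} eq = trans (sym (cast-is-id refl v)) (toList-injective refl v w eq)

∈-words : ∀ {m} (x : List Bool) → length x ≡ m → x ∈ words m
∈-words x refl = subst (_∈ words (length x)) (toList∘fromList x) (∈-map⁺ toList (∈-allWords (fromList x)))

-- Words are handled as lists, where halving, reversing and interleaving need no index arithmetic;
-- the statistics of Defs are read on lists through fromList, which computes on constructors.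
zerosL : List Bool → ℕ
zerosL x = zeros (fromList x)

onesL : List Bool → ℕ
onesL x = ones (fromList x)

o00L : List Bool → ℕ
o00L x = o00 (fromList x)

occ001L : List Bool → ℕ
occ001L x = occ001 (fromList x)

pairedZeros : List Bool → List Bool → ℕ
pairedZeros (false ∷ u) (false ∷ v) = suc (pairedZeros u v)
pairedZeros (false ∷ u) (true ∷ v)  = pairedZeros u v
pairedZeros (true ∷ u)  (_ ∷ v)     = pairedZeros u v
pairedZeros _           _           = 0

szL : ℕ → List Bool → ℕ
szL n x = pairedZeros (take n x) (take n (reverse x))

stat-fromList∘toList : (stat : ∀ {m} → Vec Bool m → ℕ) {m : ℕ} (w : Vec Bool m) →
                       stat (fromList (toList w)) ≡ stat w
stat-fromList∘toList stat w = trans (stat-cast (length-toList w) _) (cong stat (fromList∘toList w))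
  where
  stat-cast : ∀ {m m′} (eq : m ≡ m′) (v : Vec Bool m) → stat v ≡ stat (cast eq v)
  stat-cast refl v = cong stat (sym (cast-is-id refl v))

szAux-take : ∀ {m} k (u v : Vec Bool m) → szAux k u v ≡ pairedZeros (take k (toList u)) (take k (toList v))
szAux-take zero    u               v               = refl
szAux-take (suc k) Vec.[]          Vec.[]          = refl
szAux-take (suc k) (false Vec.∷ u) (false Vec.∷ v) = cong suc (szAux-take k u v)
szAux-take (suc k) (false Vec.∷ u) (true Vec.∷ v)  = szAux-take k u v
szAux-take (suc k) (true Vec.∷ u)  (_ Vec.∷ v)     = szAux-take k u v

szL-toList : ∀ n (w : Vec Bool (n + n)) → szL n (toList w) ≡ sz n w
szL-toList n w = begin
  pairedZeros (take n (toList w)) (take n (reverse (toList w)))       ≡⟨ cong (pairedZeros (take n (toList w)) ∘ take n) (toList-reverse w) ⟨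
  pairedZeros (take n (toList w)) (take n (toList (Vec.reverse w)))   ≡⟨ szAux-take n w (Vec.reverse w) ⟨
  szAux n w (Vec.reverse w)                                           ∎

zerosL+onesL : ∀ x → zerosL x + onesL x ≡ length x
zerosL+onesL []          = refl
zerosL+onesL (false ∷ x) = cong suc (zerosL+onesL x)
zerosL+onesL (true ∷ x)  = trans (+-suc (zerosL x) (onesL x)) (cong suc (zerosL+onesL x))

zerosL-not : ∀ x → zerosL (map not x) ≡ onesL x
zerosL-not []          = refl
zerosL-not (false ∷ x) = zerosL-not x
zerosL-not (true ∷ x)  = cong suc (zerosL-not x)

onesL-not : ∀ x → onesL (map not x) ≡ zerosL x
onesL-not []          = refl
onesL-not (false ∷ x) = cong suc (onesL-not x)
onesL-not (true ∷ x)  = onesL-not x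

map-not-involutive : ∀ x → map not (map not x) ≡ x
map-not-involutive x = trans (sym (map-∘ x)) (trans (map-cong not-involutive x) (map-id x))

record Additive (h : List Bool → ℕ) : Set where
  field ++-hom : ∀ x y → h (x ++ y) ≡ h x + h y

zerosL-additive : Additive zerosL
zerosL-additive = record { ++-hom = ++-hom }
  where
  ++-hom : ∀ x y → zerosL (x ++ y) ≡ zerosL x + zerosL y
  ++-hom []          y = refl
  ++-hom (false ∷ x) y = cong suc (++-hom x y)
  ++-hom (true ∷ x)  y = ++-hom x y

onesL-additive : Additive onesL
onesL-additive = record { ++-hom = ++-hom }
  where
  ++-hom : ∀ x y → onesL (x ++ y) ≡ onesL x + onesL y
  ++-hom []          y = refl
  ++-hom (false ∷ x) y = ++-hom x y
  ++-hom (true ∷ x)  y = cong suc (++-hom x y)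

length-additive : Additive length
length-additive = record { ++-hom = λ x y → length-++ x }

InGL : ℕ → List Bool → Set
InGL n x = zerosL x ≡ n × onesL x ≡ n

inGL? : ∀ n → Decidable (InGL n)
inGL? n x = (zerosL x ℕ.≟ n) ×-dec (onesL x ℕ.≟ n)

countL : ℕ → (List Bool → ℕ) → ℕ → ℕ
countL n stat k = length (filter (λ x → inGL? n x ×-dec (stat x ℕ.≟ k)) (words (n + n)))

countG≡countL : ∀ n k (stat : Vec Bool (n + n) → ℕ) (statL : List Bool → ℕ) →
                (∀ w → statL (toList w) ≡ stat w) → countG n stat k ≡ countL n statL k
countG≡countL n k stat statL stat≡ = begin
  length (filter G? ws)                           ≡⟨ cong length (filter-≐ G? (GL? ∘ toList) (G⊆GL , GL⊆G) ws) ⟩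
  length (filter (GL? ∘ toList) ws)               ≡⟨ length-map toList (filter (GL? ∘ toList) ws) ⟨
  length (map toList (filter (GL? ∘ toList) ws))  ≡⟨ cong length (filter-map GL? toList ws) ⟨
  length (filter GL? (words (n + n)))             ∎
  where
  ws = allWords (n + n)
  G : Vec Bool (n + n) → Set
  G w = (zeros w ≡ n × ones w ≡ n) × stat w ≡ k
  GL : List Bool → Set
  GL x = InGL n x × statL x ≡ k
  G? : Decidable G
  G? w = ((zeros w ℕ.≟ n) ×-dec (ones w ℕ.≟ n)) ×-dec (stat w ℕ.≟ k)
  GL? : Decidable GL
  GL? x = inGL? n x ×-dec (statL x ℕ.≟ k)
  G≡GL : ∀ w → G w ≡ GL (toList w)
  G≡GL w rewrite stat-fromList∘toList zeros w | stat-fromList∘toList ones w | stat≡ w = refl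
  G⊆GL : G ⊆ GL ∘ toList
  G⊆GL {w} = subst id (G≡GL w)
  GL⊆G : GL ∘ toList ⊆ G
  GL⊆G {w} = subst id (sym (G≡GL w))

InGL-length : ∀ n x → InGL n x → length x ≡ n + n
InGL-length n x (z , o) = trans (sym (zerosL+onesL x)) (cong₂ _+_ z o)

InGL-transport : ∀ {n} x y → (∀ {h} → Additive h → h y ≡ h x) → InGL n x → InGL n y
InGL-transport x y h≡ (z , o) = trans (h≡ zerosL-additive) z , trans (h≡ onesL-additive) o

record SubsetBijection {A B : Set} (P : A → Set) (Q : B → Set) : Set where
  field
    to       : A → B
    from     : B → A
    to-Q     : ∀ x → P x → Q (to x)
    from-P   : ∀ y → Q y → P (from y)
    from∘to  : ∀ x → P x → from (to x) ≡ x
    to∘from  : ∀ y → Q y → to (from y) ≡ y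

_∘ᴮ_ : {A B C : Set} {P : A → Set} {Q : B → Set} {R : C → Set} →
       SubsetBijection Q R → SubsetBijection P Q → SubsetBijection P R
g ∘ᴮ f = record
  { to      = G.to ∘ F.to
  ; from    = F.from ∘ G.from
  ; to-Q    = λ x Px → G.to-Q (F.to x) (F.to-Q x Px)
  ; from-P  = λ z Rz → F.from-P (G.from z) (G.from-P z Rz)
  ; from∘to = λ x Px → trans (cong F.from (G.from∘to (F.to x) (F.to-Q x Px))) (F.from∘to x Px)
  ; to∘from = λ z Rz → trans (cong G.to (F.to∘from (G.from z) (G.from-P z Rz))) (G.to∘from z Rz)
  }
  where
  module F = SubsetBijection f
  module G = SubsetBijection g

countL-bijection : ∀ {n s t} (β : SubsetBijection (InGL n) (InGL n)) →
                   (∀ x → InGL n x → t (SubsetBijection.to β x) ≡ s x) → ∀ k → countL n s k ≡ countL n t k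
countL-bijection {n} {s} {t} β t∘to k =
  length-filter-bijection (λ x → inGL? n x ×-dec (s x ℕ.≟ k)) (λ y → inGL? n y ×-dec (t y ℕ.≟ k))
    to from (λ x (x∈ , sx) → to-Q x x∈ , trans (t∘to x x∈) sx) from-P′
    (λ x → from∘to x ∘ proj₁) (λ y → to∘from y ∘ proj₁)
    (words (n + n)) (words-unique (n + n)) (in-words ∘ proj₁) (in-words ∘ proj₁)
  where
  open SubsetBijection β
  from-P′ : ∀ y → InGL n y × t y ≡ k → InGL n (from y) × s (from y) ≡ k
  from-P′ y (y∈ , ty) = from-P y y∈ , (begin
    s (from y)       ≡⟨ t∘to (from y) (from-P y y∈) ⟨
    t (to (from y))  ≡⟨ cong t (to∘from y y∈) ⟩
    t y              ≡⟨ ty ⟩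
    k                ∎)
  in-words : ∀ {x} → InGL n x → x ∈ words (n + n)
  in-words {x} x∈ = ∈-words x (InGL-length n x x∈)

module _ {A : Set} where

  interleave : List A → List A → List A
  interleave (a ∷ u) (b ∷ v) = a ∷ b ∷ interleave u v
  interleave _       _       = []

  odds : List A → List A
  odds (a ∷ _ ∷ p) = a ∷ odds p
  odds _           = []

  evens : List A → List A
  evens (_ ∷ b ∷ p) = b ∷ evens p
  evens _           = []

  odds-interleave : ∀ u v → length u ≡ length v → odds (interleave u v) ≡ u
  odds-interleave []      []      _  = refl
  odds-interleave (a ∷ u) (b ∷ v) eq = cong (a ∷_) (odds-interleave u v (suc-injective eq))

  evens-interleave : ∀ u v → length u ≡ length v → evens (interleave u v) ≡ v
  evens-interleave []      []      _  = refl
  evens-interleave (a ∷ u) (b ∷ v) eq = cong (b ∷_) (evens-interleave u v (suc-injective eq))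

  deinterleave : ∀ n (p : List A) → length p ≡ n + n →
                 ∃₂ λ u v → length u ≡ n × length v ≡ n × p ≡ interleave u v
  deinterleave zero    []          _  = [] , [] , refl , refl , refl
  deinterleave (suc n) (a ∷ b ∷ p) eq with deinterleave n p (suc-injective (trans (suc-injective eq) (+-suc n n)))
  ... | u , v , lu , lv , refl = a ∷ u , b ∷ v , cong suc lu , cong suc lv , refl
  deinterleave (suc n) (a ∷ []) eq with trans (suc-injective eq) (+-suc n n)
  ... | ()

  halves : ∀ n (x : List A) → length x ≡ n + n →
           ∃₂ λ t d → length t ≡ n × length d ≡ n × x ≡ t ++ d
  halves n x eq = take n x , drop n x
                , trans (length-take n x) (trans (cong (n ⊓_) eq) (m≤n⇒m⊓n≡m (m≤m+n n n)))
                , trans (length-drop n x) (trans (cong (_∸ n) eq) (m+n∸m≡n n n))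
                , sym (take++drop≡id n x)

  take-++ : ∀ n (t d : List A) → length t ≡ n → take n (t ++ d) ≡ t
  take-++ zero    []      d _  = refl
  take-++ (suc n) (a ∷ t) d eq = cong (a ∷_) (take-++ n t d (suc-injective eq))

  merge : List Bool → List A → List A → List A
  merge (false ∷ u) (a ∷ xs) ys       = a ∷ merge u xs ys
  merge (true ∷ u)  xs       (b ∷ ys) = b ∷ merge u xs ys
  merge _           _        _        = []

  atZeros : List Bool → List A → List A
  atZeros (false ∷ u) (a ∷ v) = a ∷ atZeros u v
  atZeros (true ∷ u)  (_ ∷ v) = atZeros u v
  atZeros _           _       = []

  atOnes : List Bool → List A → List A
  atOnes (false ∷ u) (_ ∷ v) = atOnes u v
  atOnes (true ∷ u)  (b ∷ v) = b ∷ atOnes u v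
  atOnes _           _       = []

  Fits : List Bool → List A → List A → Set
  Fits u xs ys = length xs ≡ zerosL u × length ys ≡ onesL u

  atZeros-merge : ∀ u xs ys → Fits u xs ys → atZeros u (merge u xs ys) ≡ xs
  atZeros-merge []          []       []       _         = refl
  atZeros-merge (false ∷ u) (a ∷ xs) ys       (lx , ly) = cong (a ∷_) (atZeros-merge u xs ys (suc-injective lx , ly))
  atZeros-merge (true ∷ u)  xs       (b ∷ ys) (lx , ly) = atZeros-merge u xs ys (lx , suc-injective ly)

  atOnes-merge : ∀ u xs ys → Fits u xs ys → atOnes u (merge u xs ys) ≡ ys
  atOnes-merge []          []       []       _         = refl
  atOnes-merge (false ∷ u) (a ∷ xs) ys       (lx , ly) = atOnes-merge u xs ys (suc-injective lx , ly)
  atOnes-merge (true ∷ u)  xs       (b ∷ ys) (lx , ly) = cong (b ∷_) (atOnes-merge u xs ys (lx , suc-injective ly))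

  fits-atZeros-atOnes : ∀ u v → length u ≡ length v → Fits u (atZeros u v) (atOnes u v)
  fits-atZeros-atOnes []          []      _  = refl , refl
  fits-atZeros-atOnes (false ∷ u) (_ ∷ v) eq = Product.map₁ (cong suc) (fits-atZeros-atOnes u v (suc-injective eq))
  fits-atZeros-atOnes (true ∷ u)  (_ ∷ v) eq = Product.map₂ (cong suc) (fits-atZeros-atOnes u v (suc-injective eq))

  merge-atZeros-atOnes : ∀ u v → length u ≡ length v → merge u (atZeros u v) (atOnes u v) ≡ v
  merge-atZeros-atOnes []          []      _  = refl
  merge-atZeros-atOnes (false ∷ u) (a ∷ v) eq = cong (a ∷_) (merge-atZeros-atOnes u v (suc-injective eq))
  merge-atZeros-atOnes (true ∷ u)  (b ∷ v) eq = cong (b ∷_) (merge-atZeros-atOnes u v (suc-injective eq))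

pairedZeros-merge : ∀ u xs ys → Fits u xs ys → pairedZeros u (merge u xs ys) ≡ zerosL xs
pairedZeros-merge []          []           []       _         = refl
pairedZeros-merge (false ∷ u) (false ∷ xs) ys       (lx , ly) = cong suc (pairedZeros-merge u xs ys (suc-injective lx , ly))
pairedZeros-merge (false ∷ u) (true ∷ xs)  ys       (lx , ly) = pairedZeros-merge u xs ys (suc-injective lx , ly)
pairedZeros-merge (true ∷ u)  xs           (_ ∷ ys) (lx , ly) = pairedZeros-merge u xs ys (lx , suc-injective ly)

o00L-interleave : ∀ u v → o00L (interleave u v) ≡ pairedZeros u v
o00L-interleave (false ∷ u) (false ∷ v) = cong suc (o00L-interleave u v)
o00L-interleave (false ∷ u) (true ∷ v)  = o00L-interleave u v
o00L-interleave (true ∷ u)  (_ ∷ v)     = o00L-interleave u v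
o00L-interleave []          _           = refl
o00L-interleave (false ∷ _) []          = refl
o00L-interleave (true ∷ _)  []          = refl

module _ {h : List Bool → ℕ} (additive : Additive h) where
  open Additive additive renaming (++-hom to h-++)

  additive-reverse : ∀ x → h (reverse x) ≡ h x
  additive-reverse []      = refl
  additive-reverse (a ∷ x) = begin
    h (reverse (a ∷ x))     ≡⟨ cong h (unfold-reverse a x) ⟩
    h (reverse x ++ [ a ])  ≡⟨ h-++ (reverse x) [ a ] ⟩
    h (reverse x) + h [ a ] ≡⟨ cong (_+ h [ a ]) (additive-reverse x) ⟩
    h x + h [ a ]           ≡⟨ +-comm (h x) (h [ a ]) ⟩
    h [ a ] + h x           ≡⟨ h-++ [ a ] x ⟨
    h (a ∷ x)               ∎

  additive-interleave : ∀ u v → length u ≡ length v → h (interleave u v) ≡ h u + h v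
  additive-interleave []      []      _  = h-++ [] []
  additive-interleave (a ∷ u) (b ∷ v) eq = begin
    h (a ∷ b ∷ interleave u v)                ≡⟨ h-++ [ a ] _ ⟩
    h [ a ] + h (b ∷ interleave u v)          ≡⟨ cong (h [ a ] +_) (h-++ [ b ] _) ⟩
    h [ a ] + (h [ b ] + h (interleave u v))  ≡⟨ cong (λ r → h [ a ] + (h [ b ] + r)) (additive-interleave u v (suc-injective eq)) ⟩
    h [ a ] + (h [ b ] + (h u + h v))         ≡⟨ +-assoc (h [ a ]) _ _ ⟨
    (h [ a ] + h [ b ]) + (h u + h v)         ≡⟨ interchange (h [ a ]) (h [ b ]) (h u) (h v) ⟩
    (h [ a ] + h u) + (h [ b ] + h v)         ≡⟨ sym (cong₂ _+_ (h-++ [ a ] u) (h-++ [ b ] v)) ⟩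
    h (a ∷ u) + h (b ∷ v)                     ∎

  additive-merge : ∀ u xs ys → Fits u xs ys → h (merge u xs ys) ≡ h xs + h ys
  additive-merge []          []       []       _         = h-++ [] []
  additive-merge (false ∷ u) (a ∷ xs) ys       (lx , ly) = begin
    h (a ∷ merge u xs ys)      ≡⟨ h-++ [ a ] _ ⟩
    h [ a ] + h (merge u xs ys) ≡⟨ cong (h [ a ] +_) (additive-merge u xs ys (suc-injective lx , ly)) ⟩
    h [ a ] + (h xs + h ys)     ≡⟨ +-assoc (h [ a ]) _ _ ⟨
    (h [ a ] + h xs) + h ys     ≡⟨ cong (_+ h ys) (h-++ [ a ] xs) ⟨
    h (a ∷ xs) + h ys           ∎
  additive-merge (true ∷ u)  xs       (b ∷ ys) (lx , ly) = begin
    h (b ∷ merge u xs ys)      ≡⟨ h-++ [ b ] _ ⟩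
    h [ b ] + h (merge u xs ys) ≡⟨ cong (h [ b ] +_) (additive-merge u xs ys (lx , suc-injective ly)) ⟩
    h [ b ] + (h xs + h ys)     ≡⟨ x∙yz≈y∙xz (h [ b ]) (h xs) (h ys) ⟩
    h xs + (h [ b ] + h ys)     ≡⟨ cong (h xs +_) (h-++ [ b ] ys) ⟨
    h xs + h (b ∷ ys)           ∎

  additive-interleave≡++ : ∀ u v → length u ≡ length v → h (interleave u v) ≡ h (u ++ v)
  additive-interleave≡++ u v eq = trans (additive-interleave u v eq) (sym (h-++ u v))

  additive-++-reverse : ∀ u v → h (u ++ reverse v) ≡ h (u ++ v)
  additive-++-reverse u v = begin
    h (u ++ reverse v)  ≡⟨ h-++ u (reverse v) ⟩
    h u + h (reverse v) ≡⟨ cong (h u +_) (additive-reverse v) ⟩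
    h u + h v           ≡⟨ h-++ u v ⟨
    h (u ++ v)          ∎

length-merge : ∀ u xs ys → Fits u xs ys → length (merge u xs ys) ≡ length u
length-merge u xs ys fits@(lx , ly) =
  trans (additive-merge length-additive u xs ys fits) (trans (cong₂ _+_ lx ly) (zerosL+onesL u))

foldInHalf : ℕ → List Bool → List Bool
foldInHalf n x = interleave (take n x) (take n (reverse x))

unfoldInHalf : List Bool → List Bool
unfoldInHalf p = odds p ++ reverse (evens p)

foldInHalf-++ : ∀ n t d → length t ≡ n → length d ≡ n → foldInHalf n (t ++ d) ≡ interleave t (reverse d)
foldInHalf-++ n t d lt ld = cong₂ interleave (take-++ n t d lt) (begin
  take n (reverse (t ++ d))           ≡⟨ cong (take n) (reverse-++ t d) ⟩
  take n (reverse d ++ reverse t)     ≡⟨ take-++ n (reverse d) (reverse t) (trans (length-reverse d) ld) ⟩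
  reverse d                           ∎)

unfoldInHalf-interleave : ∀ u v → length u ≡ length v → unfoldInHalf (interleave u v) ≡ u ++ reverse v
unfoldInHalf-interleave u v eq = cong₂ (λ a b → a ++ reverse b) (odds-interleave u v eq) (evens-interleave u v eq)

o00L-foldInHalf : ∀ n x → o00L (foldInHalf n x) ≡ szL n x
o00L-foldInHalf n x = o00L-interleave (take n x) (take n (reverse x))

foldInHalf-bijection : ∀ n → SubsetBijection (InGL n) (InGL n)
foldInHalf-bijection n = record
  { to      = foldInHalf n
  ; from    = unfoldInHalf
  ; to-Q    = to-InG
  ; from-P  = from-InG
  ; from∘to = from∘to
  ; to∘from = to∘from
  }
  where
  to-InG : ∀ x → InGL n x → InGL n (foldInHalf n x)
  to-InG x x∈ with halves n x (InGL-length n x x∈)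
  ... | t , d , lt , ld , refl rewrite foldInHalf-++ n t d lt ld =
    InGL-transport (t ++ d) (interleave t (reverse d)) folded-counts x∈
    where
    folded-counts : ∀ {h} → Additive h → h (interleave t (reverse d)) ≡ h (t ++ d)
    folded-counts h+ = trans (additive-interleave≡++ h+ t (reverse d) (trans lt (sym (trans (length-reverse d) ld))))
                             (additive-++-reverse h+ t d)
  from-InG : ∀ p → InGL n p → InGL n (unfoldInHalf p)
  from-InG p p∈ with deinterleave n p (InGL-length n p p∈)
  ... | u , v , lu , lv , refl rewrite unfoldInHalf-interleave u v (trans lu (sym lv)) =
    InGL-transport (interleave u v) (u ++ reverse v) unfolded-counts p∈
    where
    unfolded-counts : ∀ {h} → Additive h → h (u ++ reverse v) ≡ h (interleave u v)
    unfolded-counts h+ = trans (additive-++-reverse h+ u v) (sym (additive-interleave≡++ h+ u v (trans lu (sym lv))))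
  from∘to : ∀ x → InGL n x → unfoldInHalf (foldInHalf n x) ≡ x
  from∘to x x∈ with halves n x (InGL-length n x x∈)
  ... | t , d , lt , ld , refl = begin
    unfoldInHalf (foldInHalf n (t ++ d))     ≡⟨ cong unfoldInHalf (foldInHalf-++ n t d lt ld) ⟩
    unfoldInHalf (interleave t (reverse d))  ≡⟨ unfoldInHalf-interleave t (reverse d) t≈rd ⟩
    t ++ reverse (reverse d)                 ≡⟨ cong (t ++_) (reverse-involutive d) ⟩
    t ++ d                                   ∎
    where
    t≈rd = trans lt (sym (trans (length-reverse d) ld))
  to∘from : ∀ p → InGL n p → foldInHalf n (unfoldInHalf p) ≡ p
  to∘from p p∈ with deinterleave n p (InGL-length n p p∈)
  ... | u , v , lu , lv , refl = begin
    foldInHalf n (unfoldInHalf (interleave u v)) ≡⟨ cong (foldInHalf n) (unfoldInHalf-interleave u v u≈v) ⟩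
    foldInHalf n (u ++ reverse v)                ≡⟨ foldInHalf-++ n u (reverse v) lu (trans (length-reverse v) lv) ⟩
    interleave u (reverse (reverse v))           ≡⟨ cong (interleave u) (reverse-involutive v) ⟩
    interleave u v                               ∎
    where
    u≈v = trans lu (sym lv)

startsWithOne : List Bool → Bool
startsWithOne (true ∷ _) = true
startsWithOne _          = false

zeroMarks : List Bool → List Bool
zeroMarks []          = []
zeroMarks (false ∷ w) = startsWithOne w ∷ zeroMarks w
zeroMarks (true ∷ w)  = zeroMarks w

-- The flag says whether the previous letter was 0.
oneMarks′ : Bool → List Bool → List Bool
oneMarks′ _ []          = []
oneMarks′ _ (false ∷ w) = oneMarks′ true w
oneMarks′ b (true ∷ w)  = b ∷ oneMarks′ false w

oneMarks : List Bool → List Bool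
oneMarks = oneMarks′ false

-- decode reads the marks after a 1 (or at the start), decodeZeros when the next letter must be 0.
decode : List Bool → List Bool → List Bool
decodeZeros : List Bool → List Bool → List Bool
decode zs (false ∷ os) = true ∷ decode zs os
decode zs os           = decodeZeros zs os
decodeZeros (false ∷ zs) os           = false ∷ decodeZeros zs os
decodeZeros (true ∷ zs)  (true ∷ os)  = false ∷ true ∷ decode zs os
decodeZeros _            _            = []

length-zeroMarks : ∀ w → length (zeroMarks w) ≡ zerosL w
length-zeroMarks []          = refl
length-zeroMarks (false ∷ w) = cong suc (length-zeroMarks w)
length-zeroMarks (true ∷ w)  = length-zeroMarks w

length-oneMarks′ : ∀ b w → length (oneMarks′ b w) ≡ onesL w
length-oneMarks′ _ []          = refl
length-oneMarks′ _ (false ∷ w) = length-oneMarks′ true w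
length-oneMarks′ _ (true ∷ w)  = cong suc (length-oneMarks′ false w)

onesL-oneMarks : ∀ w → onesL (oneMarks w) ≡ onesL (zeroMarks w)
onesL-oneMarks []          = refl
onesL-oneMarks (true ∷ w)  = onesL-oneMarks w
onesL-oneMarks (false ∷ w) = begin
  onesL (oneMarks′ true w)                 ≡⟨ after-zero w ⟩
  onesL (startsWithOne w ∷ oneMarks w)     ≡⟨ ++-hom [ startsWithOne w ] (oneMarks w) ⟩
  onesL [ startsWithOne w ] + onesL (oneMarks w)  ≡⟨ cong (onesL [ startsWithOne w ] +_) (onesL-oneMarks w) ⟩
  onesL [ startsWithOne w ] + onesL (zeroMarks w) ≡⟨ ++-hom [ startsWithOne w ] (zeroMarks w) ⟨
  onesL (startsWithOne w ∷ zeroMarks w)    ∎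
  where
  open Additive onesL-additive
  after-zero : ∀ w → onesL (oneMarks′ true w) ≡ onesL (startsWithOne w ∷ oneMarks w)
  after-zero []          = refl
  after-zero (false ∷ w) = refl
  after-zero (true ∷ w)  = refl

decode-marks : ∀ w → decode (zeroMarks w) (oneMarks w) ≡ w
decodeZeros-marks : ∀ w → decodeZeros (startsWithOne w ∷ zeroMarks w) (oneMarks′ true w) ≡ false ∷ w
decode-marks []          = refl
decode-marks (true ∷ w)  = cong (true ∷_) (decode-marks w)
decode-marks (false ∷ w) = trans (decode-after-zero (zeroMarks (false ∷ w)) w) (decodeZeros-marks w)
  where
  decode-after-zero : ∀ zs w → decode zs (oneMarks′ true w) ≡ decodeZeros zs (oneMarks′ true w)
  decode-after-zero zs []          = refl
  decode-after-zero zs (true ∷ w)  = refl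
  decode-after-zero zs (false ∷ w) = decode-after-zero zs w
decodeZeros-marks []          = refl
decodeZeros-marks (true ∷ w)  = cong (λ r → false ∷ true ∷ r) (decode-marks w)
decodeZeros-marks (false ∷ w) = cong (false ∷_) (decodeZeros-marks w)

startsWithOne-decodeZeros : ∀ zs os → startsWithOne (decodeZeros zs os) ≡ false
startsWithOne-decodeZeros (false ∷ zs) os           = refl
startsWithOne-decodeZeros (true ∷ zs)  (true ∷ os)  = refl
startsWithOne-decodeZeros (true ∷ zs)  (false ∷ os) = refl
startsWithOne-decodeZeros (true ∷ zs)  []           = refl
startsWithOne-decodeZeros []           os           = refl

oneMarks-decodeZeros : ∀ zs os → oneMarks (decodeZeros zs os) ≡ oneMarks′ true (decodeZeros zs os)
oneMarks-decodeZeros (false ∷ zs) os           = refl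
oneMarks-decodeZeros (true ∷ zs)  (true ∷ os)  = refl
oneMarks-decodeZeros (true ∷ zs)  (false ∷ os) = refl
oneMarks-decodeZeros (true ∷ zs)  []           = refl
oneMarks-decodeZeros []           os           = refl

marks-decode : ∀ zs os → onesL zs ≡ onesL os → zeroMarks (decode zs os) ≡ zs × oneMarks (decode zs os) ≡ os
marks-decodeZeros : ∀ zs os → onesL zs ≡ onesL os → startsWithOne os ≡ true ⊎ os ≡ [] →
                    zeroMarks (decodeZeros zs os) ≡ zs × oneMarks′ true (decodeZeros zs os) ≡ os
marks-decode zs (false ∷ os) eq = Product.map₂ (cong (false ∷_)) (marks-decode zs os eq)
marks-decode zs (true ∷ os)  eq =
  Product.map₂ (trans (oneMarks-decodeZeros zs (true ∷ os))) (marks-decodeZeros zs (true ∷ os) eq (inj₁ refl))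
marks-decode zs []           eq =
  Product.map₂ (trans (oneMarks-decodeZeros zs [])) (marks-decodeZeros zs [] eq (inj₂ refl))
marks-decodeZeros (false ∷ zs) os           eq os₁ =
  Product.map₁ (cong₂ _∷_ (startsWithOne-decodeZeros zs os)) (marks-decodeZeros zs os eq os₁)
marks-decodeZeros (true ∷ zs)  (true ∷ os)  eq _   =
  Product.map (cong (true ∷_)) (cong (true ∷_)) (marks-decode zs os (suc-injective eq))
marks-decodeZeros []           []           _  _   = refl , refl
marks-decodeZeros []           (true ∷ _)   ()
marks-decodeZeros _            (false ∷ _)  _  (inj₁ ())
marks-decodeZeros _            (false ∷ _)  _  (inj₂ ())

occ001L-marks : ∀ w → occ001L w ≡ onesL (oneMarks (zeroMarks w))
occ001L-marks []                      = refl
occ001L-marks (true ∷ w)              = occ001L-marks w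
occ001L-marks (false ∷ [])            = refl
occ001L-marks (false ∷ true ∷ w)      = occ001L-marks w
occ001L-marks (false ∷ false ∷ [])    = refl
occ001L-marks (false ∷ false ∷ true ∷ w)  = cong suc (occ001L-marks w)
occ001L-marks (false ∷ false ∷ false ∷ w) = occ001L-marks (false ∷ false ∷ w)

Triple : Set
Triple = List Bool × List Bool × List Bool

MarkTriple : ℕ → Triple → Set
MarkTriple n (o₁ , o₂ , z₂) =
  length o₁ ≡ n × length o₂ ≡ onesL o₁ × length z₂ ≡ zerosL o₁ × onesL z₂ ≡ onesL o₂

markTwice : List Bool → Triple
markTwice w = oneMarks w , oneMarks (zeroMarks w) , zeroMarks (zeroMarks w)

unmarkTwice : Triple → List Bool
unmarkTwice (o₁ , o₂ , z₂) = decode (decode z₂ o₂) o₁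

pairUp : Triple → List Bool
pairUp (o₁ , o₂ , z₂) = interleave (map not o₁) (merge (map not o₁) (map not o₂) z₂)

unpair : List Bool → Triple
unpair p = map not (odds p) , map not (atZeros (odds p) (evens p)) , atOnes (odds p) (evens p)

unpair-interleave : ∀ u v → length u ≡ length v →
                    unpair (interleave u v) ≡ (map not u , map not (atZeros u v) , atOnes u v)
unpair-interleave u v eq =
  cong₂ (λ a b → map not a , map not (atZeros a b) , atOnes a b) (odds-interleave u v eq) (evens-interleave u v eq)

pairUp-fits : ∀ o₁ o₂ z₂ → length o₂ ≡ onesL o₁ → length z₂ ≡ zerosL o₁ →
              Fits (map not o₁) (map not o₂) z₂
pairUp-fits o₁ o₂ z₂ l₂ l₃ =
  trans (length-map not o₂) (trans l₂ (sym (zerosL-not o₁))) , trans l₃ (sym (onesL-not o₁))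

module _ (o₁ o₂ z₂ : List Bool) (l₂ : length o₂ ≡ onesL o₁) (l₃ : length z₂ ≡ zerosL o₁) where
  private
    u = map not o₁
    fits = pairUp-fits o₁ o₂ z₂ l₂ l₃
    v = merge u (map not o₂) z₂
    u≈v : length u ≡ length v
    u≈v = sym (length-merge u (map not o₂) z₂ fits)

  additive-pairUp : ∀ {h} → Additive h →
                    h (pairUp (o₁ , o₂ , z₂)) ≡ h (map not o₁) + (h (map not o₂) + h z₂)
  additive-pairUp {h} h+ =
    trans (additive-interleave h+ u v u≈v) (cong (h u +_) (additive-merge h+ u (map not o₂) z₂ fits))

  o00L-pairUp : o00L (pairUp (o₁ , o₂ , z₂)) ≡ onesL o₂
  o00L-pairUp = trans (o00L-interleave u _) (trans (pairedZeros-merge u (map not o₂) z₂ fits) (zerosL-not o₂))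

  unpair-pairUp : unpair (pairUp (o₁ , o₂ , z₂)) ≡ (o₁ , o₂ , z₂)
  unpair-pairUp = begin
    unpair (interleave u v)                             ≡⟨ unpair-interleave u v u≈v ⟩
    map not u , map not (atZeros u v) , atOnes u v
      ≡⟨ cong₂ (λ a b → a , map not b , atOnes u v) (map-not-involutive o₁) (atZeros-merge u (map not o₂) z₂ fits) ⟩
    o₁ , map not (map not o₂) , atOnes u v
      ≡⟨ cong₂ (λ a b → o₁ , a , b) (map-not-involutive o₂) (atOnes-merge u (map not o₂) z₂ fits) ⟩
    o₁ , o₂ , z₂                                        ∎

pairUp-unpair : ∀ u v → length u ≡ length v → pairUp (unpair (interleave u v)) ≡ interleave u v
pairUp-unpair u v eq = begin
  pairUp (unpair (interleave u v))
    ≡⟨ cong pairUp (unpair-interleave u v eq) ⟩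
  interleave (map not (map not u)) (merge (map not (map not u)) (map not (map not (atZeros u v))) (atOnes u v))
    ≡⟨ cong₂ (λ a b → interleave a (merge a b (atOnes u v))) (map-not-involutive u) (map-not-involutive (atZeros u v)) ⟩
  interleave u (merge u (atZeros u v) (atOnes u v))
    ≡⟨ cong (interleave u) (merge-atZeros-atOnes u v eq) ⟩
  interleave u v
    ∎

unpair-markTriple : ∀ n u v → length u ≡ n → length v ≡ n → InGL n (interleave u v) →
                    MarkTriple n (map not u , map not (atZeros u v) , atOnes u v)
unpair-markTriple n u v lu lv (zeros≡ , _) =
  trans (length-map not u) lu ,
  trans (length-map not xs) (trans lx (sym (onesL-not u))) ,
  trans ly (sym (zerosL-not u)) ,
  trans (sym balance) (sym (onesL-not xs))
  where
  xs = atZeros u v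
  ys = atOnes u v
  u≈v = trans lu (sym lv)
  fits = fits-atZeros-atOnes u v u≈v
  lx = proj₁ fits
  ly = proj₂ fits
  zeros-split : zerosL u + (zerosL xs + zerosL ys) ≡ zerosL u + onesL u
  zeros-split = begin
    zerosL u + (zerosL xs + zerosL ys)  ≡⟨ cong (zerosL u +_) (additive-merge zerosL-additive u xs ys fits) ⟨
    zerosL u + zerosL (merge u xs ys)   ≡⟨ cong (λ r → zerosL u + zerosL r) (merge-atZeros-atOnes u v u≈v) ⟩
    zerosL u + zerosL v                 ≡⟨ additive-interleave zerosL-additive u v u≈v ⟨
    zerosL (interleave u v)             ≡⟨ trans zeros≡ (sym lu) ⟩
    length u                            ≡⟨ zerosL+onesL u ⟨
    zerosL u + onesL u                  ∎
  balance : zerosL xs ≡ onesL ys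
  balance = +-cancelʳ-≡ (zerosL ys) (zerosL xs) (onesL ys) (begin
    zerosL xs + zerosL ys  ≡⟨ +-cancelˡ-≡ (zerosL u) _ _ zeros-split ⟩
    onesL u                ≡⟨ ly ⟨
    length ys              ≡⟨ zerosL+onesL ys ⟨
    zerosL ys + onesL ys   ≡⟨ +-comm (zerosL ys) (onesL ys) ⟩
    onesL ys + zerosL ys   ∎)

pairUp-bijection : ∀ n → SubsetBijection (MarkTriple n) (InGL n)
pairUp-bijection n = record
  { to      = pairUp
  ; from    = unpair
  ; to-Q    = to-InG
  ; from-P  = from-InG
  ; from∘to = λ (o₁ , o₂ , z₂) (_ , l₂ , l₃ , _) → unpair-pairUp o₁ o₂ z₂ l₂ l₃
  ; to∘from = to∘from
  }
  where
  to-InG : ∀ τ → MarkTriple n τ → InGL n (pairUp τ)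
  to-InG (o₁ , o₂ , z₂) (l₁ , l₂ , l₃ , balanced) = zeros-pairUp , ones-pairUp
    where
    zeros-pairUp : zerosL (pairUp (o₁ , o₂ , z₂)) ≡ n
    zeros-pairUp = begin
      zerosL (pairUp (o₁ , o₂ , z₂))                          ≡⟨ additive-pairUp o₁ o₂ z₂ l₂ l₃ zerosL-additive ⟩
      zerosL (map not o₁) + (zerosL (map not o₂) + zerosL z₂) ≡⟨ cong₂ (λ a b → a + (b + zerosL z₂)) (zerosL-not o₁) (zerosL-not o₂) ⟩
      onesL o₁ + (onesL o₂ + zerosL z₂)                       ≡⟨ cong (λ a → onesL o₁ + (a + zerosL z₂)) balanced ⟨
      onesL o₁ + (onesL z₂ + zerosL z₂)                       ≡⟨ cong (onesL o₁ +_) (+-comm (onesL z₂) (zerosL z₂)) ⟩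
      onesL o₁ + (zerosL z₂ + onesL z₂)                       ≡⟨ cong (onesL o₁ +_) (trans (zerosL+onesL z₂) l₃) ⟩
      onesL o₁ + zerosL o₁                                    ≡⟨ +-comm (onesL o₁) (zerosL o₁) ⟩
      zerosL o₁ + onesL o₁                                    ≡⟨ trans (zerosL+onesL o₁) l₁ ⟩
      n                                                       ∎
    ones-pairUp : onesL (pairUp (o₁ , o₂ , z₂)) ≡ n
    ones-pairUp = begin
      onesL (pairUp (o₁ , o₂ , z₂))                           ≡⟨ additive-pairUp o₁ o₂ z₂ l₂ l₃ onesL-additive ⟩
      onesL (map not o₁) + (onesL (map not o₂) + onesL z₂)    ≡⟨ cong₂ (λ a b → a + (b + onesL z₂)) (onesL-not o₁) (onesL-not o₂) ⟩
      zerosL o₁ + (zerosL o₂ + onesL z₂)                      ≡⟨ cong (λ a → zerosL o₁ + (zerosL o₂ + a)) balanced ⟩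
      zerosL o₁ + (zerosL o₂ + onesL o₂)                      ≡⟨ cong (zerosL o₁ +_) (trans (zerosL+onesL o₂) l₂) ⟩
      zerosL o₁ + onesL o₁                                    ≡⟨ trans (zerosL+onesL o₁) l₁ ⟩
      n                                                       ∎
  from-InG : ∀ p → InGL n p → MarkTriple n (unpair p)
  from-InG p p∈ with deinterleave n p (InGL-length n p p∈)
  ... | u , v , lu , lv , refl =
    subst (MarkTriple n) (sym (unpair-interleave u v (trans lu (sym lv)))) (unpair-markTriple n u v lu lv p∈)
  to∘from : ∀ p → InGL n p → pairUp (unpair p) ≡ p
  to∘from p p∈ with deinterleave n p (InGL-length n p p∈)
  ... | u , v , lu , lv , refl = pairUp-unpair u v (trans lu (sym lv))

counts-decode : ∀ zs os → onesL zs ≡ onesL os →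
                zerosL (decode zs os) ≡ length zs × onesL (decode zs os) ≡ length os
counts-decode zs os eq with marks-decode zs os eq
... | zm , om = trans (sym (length-zeroMarks (decode zs os))) (cong length zm) ,
                trans (sym (length-oneMarks′ false (decode zs os))) (cong length om)

module _ (o₁ o₂ z₂ : List Bool) (l₂ : length o₂ ≡ onesL o₁) (l₃ : length z₂ ≡ zerosL o₁)
         (balanced : onesL z₂ ≡ onesL o₂) where
  private
    z₁ = decode z₂ o₂
    counts₁ = counts-decode z₂ o₂ balanced
    ones≡₁ : onesL z₁ ≡ onesL o₁
    ones≡₁ = trans (proj₂ counts₁) l₂

  counts-unmarkTwice : zerosL (unmarkTwice (o₁ , o₂ , z₂)) ≡ length o₁ ×
                       onesL (unmarkTwice (o₁ , o₂ , z₂)) ≡ length o₁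
  counts-unmarkTwice = trans zeros-w length-z₁ , proj₂ (counts-decode z₁ o₁ ones≡₁)
    where
    zeros-w = proj₁ (counts-decode z₁ o₁ ones≡₁)
    length-z₁ : length z₁ ≡ length o₁
    length-z₁ = begin
      length z₁             ≡⟨ zerosL+onesL z₁ ⟨
      zerosL z₁ + onesL z₁  ≡⟨ cong₂ _+_ (trans (proj₁ counts₁) l₃) ones≡₁ ⟩
      zerosL o₁ + onesL o₁  ≡⟨ zerosL+onesL o₁ ⟩
      length o₁             ∎

  markTwice-unmarkTwice : markTwice (unmarkTwice (o₁ , o₂ , z₂)) ≡ (o₁ , o₂ , z₂)
  markTwice-unmarkTwice with marks-decode z₂ o₂ balanced | marks-decode z₁ o₁ ones≡₁
  ... | zm₂ , om₂ | zm₁ , om₁ =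
    cong₂ _,_ om₁ (cong₂ _,_ (trans (cong oneMarks zm₁) om₂) (trans (cong zeroMarks zm₁) zm₂))

markTwice-bijection : ∀ n → SubsetBijection (InGL n) (MarkTriple n)
markTwice-bijection n = record
  { to      = markTwice
  ; from    = unmarkTwice
  ; to-Q    = to-MarkTriple
  ; from-P  = from-InG
  ; from∘to = λ w _ → trans (cong (λ z → decode z (oneMarks w)) (decode-marks (zeroMarks w))) (decode-marks w)
  ; to∘from = to∘from
  }
  where
  to-MarkTriple : ∀ w → InGL n w → MarkTriple n (markTwice w)
  to-MarkTriple w (zeros≡ , ones≡) =
    trans (length-oneMarks′ false w) ones≡ ,
    trans (length-oneMarks′ false z₁) (sym (onesL-oneMarks w)) ,
    trans (length-zeroMarks z₁) zeros-marks ,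
    sym (onesL-oneMarks z₁)
    where
    z₁ = zeroMarks w
    o₁ = oneMarks w
    zeros-marks : zerosL z₁ ≡ zerosL o₁
    zeros-marks = +-cancelʳ-≡ (onesL z₁) (zerosL z₁) (zerosL o₁) (begin
      zerosL z₁ + onesL z₁  ≡⟨ zerosL+onesL z₁ ⟩
      length z₁             ≡⟨ trans (length-zeroMarks w) zeros≡ ⟩
      n                     ≡⟨ trans (length-oneMarks′ false w) ones≡ ⟨
      length o₁             ≡⟨ zerosL+onesL o₁ ⟨
      zerosL o₁ + onesL o₁  ≡⟨ cong (zerosL o₁ +_) (onesL-oneMarks w) ⟩
      zerosL o₁ + onesL z₁  ∎)
  from-InG : ∀ τ → MarkTriple n τ → InGL n (unmarkTwice τ)
  from-InG (o₁ , o₂ , z₂) (l₁ , l₂ , l₃ , balanced) =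
    Product.map (λ e → trans e l₁) (λ e → trans e l₁) (counts-unmarkTwice o₁ o₂ z₂ l₂ l₃ balanced)
  to∘from : ∀ τ → MarkTriple n τ → markTwice (unmarkTwice τ) ≡ τ
  to∘from (o₁ , o₂ , z₂) (_ , l₂ , l₃ , balanced) = markTwice-unmarkTwice o₁ o₂ z₂ l₂ l₃ balanced

o00L-pairUp-markTwice : ∀ n w → InGL n w → o00L (pairUp (markTwice w)) ≡ occ001L w
o00L-pairUp-markTwice n w w∈ with SubsetBijection.to-Q (markTwice-bijection n) w w∈
... | _ , l₂ , l₃ , _ =
  trans (o00L-pairUp (oneMarks w) (oneMarks (zeroMarks w)) (zeroMarks (zeroMarks w)) l₂ l₃) (sym (occ001L-marks w))

theorem3p3 : (n k : ℕ) →
    (countG n (sz n) k ≡ countG n o00 k) × (countG n o00 k ≡ countG n occ001 k)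
theorem3p3 n k = sz≡o00 , o00≡occ001
  where
  o00-toList = stat-fromList∘toList o00
  sz≡o00 : countG n (sz n) k ≡ countG n o00 k
  sz≡o00 = begin
    countG n (sz n) k   ≡⟨ countG≡countL n k (sz n) (szL n) (szL-toList n) ⟩
    countL n (szL n) k  ≡⟨ countL-bijection (foldInHalf-bijection n) (λ x _ → o00L-foldInHalf n x) k ⟩
    countL n o00L k     ≡⟨ countG≡countL n k o00 o00L o00-toList ⟨
    countG n o00 k      ∎
  o00≡occ001 : countG n o00 k ≡ countG n occ001 k
  o00≡occ001 = begin
    countG n o00 k      ≡⟨ countG≡countL n k o00 o00L o00-toList ⟩
    countL n o00L k     ≡⟨ countL-bijection (pairUp-bijection n ∘ᴮ markTwice-bijection n) (o00L-pairUp-markTwice n) k ⟨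
    countL n occ001L k  ≡⟨ countG≡countL n k occ001 occ001L (stat-fromList∘toList occ001) ⟨
    countG n occ001 k   ∎
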